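{- Let $n,m \geq 1$ with $n+m \geq 3$, and let $K_{n,m}$ be the complete bipartite graph with parts of sizes $n$ and $m$. Then ${\rm ML}^{\rm W}(K_{n,m})=0$ if $n \neq m$, and ${\rm ML}^{\rm W}(K_{n,m})=2n-2$ if $n=m \geq 2$.
   Context: A walk of a graph $G$ is a sequence of vertices in which consecutive vertices are adjacent (repetitions allowed); its length is its number of traversed edges with repetition (a single vertex is a walk of length $0$). For a walk $W$, $G+W$ is the multigraph on $V(G)$ with edge multiset $E(G)$ plus every edge traversed by $W$, added as many times as traversed. A multigraph is locally irregular if no two adjacent vertices have the same degree; $W$ is irregularising if $G+W$ is locally irregular. ${\rm ML}^{\rm W}(G)$ is the minimum length of an irregularising walk of $G$, $+\infty$ if none exists. -}

module Defs where

open import Data.Nat using (ℕ; zero; suc; _+_; _<ᵇ_; _≤_)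
open import Data.Bool using (Bool; true; false; if_then_else_; _xor_; _∧_; _∨_; T)
open import Data.Fin using (Fin; toℕ; _≟_)
open import Data.List using (List; []; _∷_; length; map; allFin)
open import Data.Nat.ListAction using (sum)
open import Data.Unit using (⊤)
open import Data.Product using (Σ; _×_; _,_; ∃)
open import Relation.Nullary using (¬_)
open import Relation.Nullary.Decidable using (⌊_⌋)
open import Relation.Binary.PropositionalEquality using (_≡_; _≢_)
open import Data.Empty using (⊥)

record Graph : Set where
  field
    N     : ℕ
    adj   : Fin N → Fin N → Bool
    sym   : ∀ u v → adj u v ≡ adj v u
    irrefl : ∀ u → adj u u ≡ false
open Graph public

-- Complete bipartite graph K_{n,m}: vertices 0..n-1 form one part,
-- n..n+m-1 the other; u ~ v iff they lie in different parts.
inA : (n : ℕ) {k : ℕ} → Fin k → Bool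
inA n u = toℕ u <ᵇ n

xor-self : ∀ b → b xor b ≡ false
xor-self true = Relation.Binary.PropositionalEquality.refl
xor-self false = Relation.Binary.PropositionalEquality.refl

xor-comm : ∀ a b → a xor b ≡ b xor a
xor-comm true true = Relation.Binary.PropositionalEquality.refl
xor-comm true false = Relation.Binary.PropositionalEquality.refl
xor-comm false true = Relation.Binary.PropositionalEquality.refl
xor-comm false false = Relation.Binary.PropositionalEquality.refl

K : ℕ → ℕ → Graph
K n m = record
  { N = n + m
  ; adj = λ u v → inA n u xor inA n v
  ; sym = λ u v → xor-comm (inA n u) (inA n v)
  ; irrefl = λ u → xor-self (inA n u)
  }

Steps : (G : Graph) → Fin (N G) → List (Fin (N G)) → Set
Steps G x [] = ⊤
Steps G x (y ∷ ys) = T (adj G x y) × Steps G y ys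

record Walk (G : Graph) : Set where
  constructor walk
  field
    start : Fin (N G)
    rest  : List (Fin (N G))
    valid : Steps G start rest
open Walk public

walkLength : {G : Graph} → Walk G → ℕ
walkLength W = length (rest W)

eqB : {k : ℕ} → Fin k → Fin k → Bool
eqB a b = ⌊ a ≟ b ⌋

trav : {k : ℕ} → Fin k → List (Fin k) → Fin k → Fin k → ℕ
trav x [] u v = 0
trav x (y ∷ ys) u v =
  (if (eqB x u ∧ eqB y v) ∨ (eqB x v ∧ eqB y u) then 1 else 0) + trav y ys u v

-- G + W : edge multiplicity of {u,v} in the multigraph
mult : (G : Graph) → Walk G → Fin (N G) → Fin (N G) → ℕ
mult G W u v = (if adj G u v then 1 else 0) + trav (start W) (rest W) u v

deg : (G : Graph) → Walk G → Fin (N G) → ℕ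
deg G W u = sum (map (mult G W u) (allFin (N G)))

Adjacent : (G : Graph) → Walk G → Fin (N G) → Fin (N G) → Set
Adjacent G W u v = ¬ (mult G W u v ≡ 0)

LocallyIrregular : (G : Graph) → Walk G → Set
LocallyIrregular G W = ∀ u v → Adjacent G W u v → deg G W u ≢ deg G W v

Irregularising : (G : Graph) → Walk G → Set
Irregularising G W = LocallyIrregular G W

-- ML^W(G) = k  (k a finite value): some irregularising walk has length k,
-- and every irregularising walk has length ≥ k.
MLW≡ : Graph → ℕ → Set
MLW≡ G k = (Σ (Walk G) λ W → Irregularising G W × walkLength W ≡ k)
         × (∀ (W : Walk G) → Irregularising G W → k ≤ walkLength W)

{-# OPTIONS --safe #-}
-- In K n m + W a vertex of the first part has degree m + d(a) and a vertex of the second part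
-- degree n + d(b), where d counts the traversals of W at a vertex; and only vertices of
-- different parts are adjacent. So for n ≢ m the empty walk is irregularising. For n ≡ m an
-- irregularising walk cannot miss a vertex in each part (both would have degree n), hence it
-- visits all n vertices of one part, and since a walk alternates between the parts its length
-- is at least 2n − 2. The star walk a₀ h a₁ h ⋯ h aₙ₋₁ around one hub h attains this bound:
-- by the handshake identity d(u) + [u is the start] + [u is the end] = 2 · (visits of u) the
-- hub gets 2n − 2, each aᵢ gets 1 or 2, and the rest of the hub's part gets 0.
module Submission where

open import Defs renaming (sym to adj-sym)
open import Data.Bool using (Bool; true; false; if_then_else_; _∧_; _∨_; _xor_; not; T)
open import Data.Bool.Properties using (T?; T-≡; ∧-zeroʳ; ∧-identityʳ; ∨-identityʳ)
open import Data.Empty using (⊥; ⊥-elim)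
open import Data.Fin using (Fin; zero; suc; fromℕ; _↑ˡ_; _↑ʳ_; splitAt)
open import Data.Fin.Properties
  using (_≟_; suc-injective; ↑ˡ-injective; ↑ʳ-injective; splitAt⁻¹-↑ˡ; splitAt⁻¹-↑ʳ; injective⇒≤;
         all?; ¬∀⟶∃¬)
open import Data.List using (List; []; _∷_; map; tabulate; length; filterᵇ; lookup)
open import Data.List.Membership.Propositional using (_∈_; _∉_)
open import Data.List.Membership.Propositional.Properties using (∈-filter⁺)
open import Data.List.Properties using (length-tabulate)
open import Data.List.Relation.Unary.All using (All; []; _∷_)
open import Data.List.Relation.Unary.All.Properties using (tabulate⁺)
open import Data.List.Relation.Unary.Any using (here; there; index; any?)
open import Data.List.Relation.Unary.Any.Properties using (lookup-index)
open import Data.Nat using (ℕ; zero; suc; _+_; _*_; _∸_; _≤_; s≤s; z≤n)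
open import Data.Nat.ListAction using (sum)
open import Data.Nat.Properties
  using (+-0-commutativeMonoid; +-assoc; +-identityʳ; +-cancelˡ-≡; +-cancelʳ-≡; *-suc; *-zeroʳ; *-identityʳ;
         *-distribˡ-+; m+n≡0⇒m≡0; ≤-trans; m≤m+n; +-monoʳ-≤; +-monoˡ-≤; *-monoʳ-≤; m≤n+o⇒m∸n≤o;
         module ≤-Reasoning)
open import Data.Nat.Solver using (module +-*-Solver)
open import Algebra.Properties.CommutativeMonoid.Sum +-0-commutativeMonoid
  using (sum-syntax; sum-cong-≗; ∑-distrib-+; sum-replicate-zero) renaming (sum to ∑)
open import Data.Product using (_×_; _,_)
open import Data.Sum using (_⊎_; inj₁; inj₂)
open import Data.Unit using (tt)
open import Function using (_∘_; id)
open import Function.Bundles using (Equivalence)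
open import Function.Definitions using (Injective)
open import Relation.Nullary using (¬_; Dec; yes; no)
open import Relation.Binary.PropositionalEquality
  using (_≡_; _≢_; refl; sym; trans; cong; cong₂; subst; module ≡-Reasoning)

𝟙 : Bool → ℕ
𝟙 b = if b then 1 else 0

𝟙≤1 : ∀ b → 𝟙 b ≤ 1
𝟙≤1 true  = s≤s z≤n
𝟙≤1 false = z≤n

𝟙+𝟙-not : ∀ b → 𝟙 b + 𝟙 (not b) ≡ 1
𝟙+𝟙-not true  = refl
𝟙+𝟙-not false = refl

sum-map-tabulate : ∀ {n} {A : Set} (g : A → ℕ) (f : Fin n → A) →
                   sum (map g (tabulate f)) ≡ ∑[ i < n ] g (f i)
sum-map-tabulate {zero}  g f = refl
sum-map-tabulate {suc n} g f = cong (g (f zero) +_) (sum-map-tabulate g (f ∘ suc))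

∑-ones : ∀ n → ∑[ i < n ] 1 ≡ n
∑-ones zero    = refl
∑-ones (suc n) = cong suc (∑-ones n)

∑-↑ˡ-↑ʳ : ∀ n m (f : Fin (n + m) → ℕ) →
          ∑[ u < n + m ] f u ≡ ∑[ i < n ] f (i ↑ˡ m) + ∑[ j < m ] f (n ↑ʳ j)
∑-↑ˡ-↑ʳ zero    m f = refl
∑-↑ˡ-↑ʳ (suc n) m f = trans (cong (f zero +_) (∑-↑ˡ-↑ʳ n m (f ∘ suc))) (sym (+-assoc (f zero) _ _))

eqB-refl : ∀ {k} (a : Fin k) → eqB a a ≡ true
eqB-refl a with a ≟ a
... | yes _  = refl
... | no a≢a = ⊥-elim (a≢a refl)

eqB-≢ : ∀ {k} {a b : Fin k} → a ≢ b → eqB a b ≡ false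
eqB-≢ {a = a} {b} a≢b with a ≟ b
... | yes a≡b = ⊥-elim (a≢b a≡b)
... | no _    = refl

eqB-comm : ∀ {k} (a b : Fin k) → eqB a b ≡ eqB b a
eqB-comm a b with a ≟ b
... | yes refl = sym (eqB-refl a)
... | no a≢b   = sym (eqB-≢ (a≢b ∘ sym))

eqB-injective : ∀ {k l} {f : Fin k → Fin l} → Injective _≡_ _≡_ f → ∀ a b → eqB (f a) (f b) ≡ eqB a b
eqB-injective {f = f} f-inj a b with a ≟ b
... | yes refl = eqB-refl (f a)
... | no a≢b   = eqB-≢ (a≢b ∘ f-inj)

∑-indicator : ∀ {k} (a : Fin k) → ∑[ w < k ] 𝟙 (eqB a w) ≡ 1
∑-indicator {suc k} zero    = cong suc (sum-replicate-zero k)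
∑-indicator {suc k} (suc a) =
  trans (sum-cong-≗ (cong 𝟙 ∘ eqB-injective suc-injective a)) (∑-indicator a)

distinct⇒𝟙+𝟙≢2 : ∀ {k} {a b : Fin k} → a ≢ b → ∀ i → 𝟙 (eqB a i) + 𝟙 (eqB b i) ≢ 2
distinct⇒𝟙+𝟙≢2 {a = a} {b} a≢b i with a ≟ i | b ≟ i
... | yes refl | yes refl = λ _ → a≢b refl
... | yes _    | no _     = λ ()
... | no _     | yes _    = λ ()
... | no _     | no _     = λ ()

walkDegree : ∀ {k} → Fin k → List (Fin k) → Fin k → ℕ
walkDegree {k} x ys u = ∑[ w < k ] trav x ys u w

degree : (G : Graph) → Fin (N G) → ℕ
degree G u = ∑[ w < N G ] 𝟙 (adj G u w)

deg≡degree+walkDegree : ∀ {G} (W : Walk G) u → deg G W u ≡ degree G u + walkDegree (start W) (rest W) u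
deg≡degree+walkDegree {G} W u =
  trans (sum-map-tabulate (mult G W u) id) (∑-distrib-+ (𝟙 ∘ adj G u) (trav (start W) (rest W) u))

∑-step-indicator : ∀ {k} {x y : Fin k} → x ≢ y → ∀ u →
  ∑[ w < k ] 𝟙 ((eqB x u ∧ eqB y w) ∨ (eqB x w ∧ eqB y u)) ≡ 𝟙 (eqB x u) + 𝟙 (eqB y u)
∑-step-indicator {k} {x} {y} x≢y u with x ≟ u | y ≟ u
... | yes refl | yes refl = ⊥-elim (x≢y refl)
... | yes refl | no _     = trans (sum-cong-≗ λ w → cong 𝟙 (trans (cong (eqB y w ∨_) (∧-zeroʳ (eqB x w)))
                                                                    (∨-identityʳ (eqB y w))))
                                  (∑-indicator y)
... | no _     | yes refl = trans (sum-cong-≗ λ w → cong 𝟙 (∧-identityʳ (eqB x w))) (∑-indicator x)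
... | no _     | no _     = trans (sum-cong-≗ λ w → cong 𝟙 (∧-zeroʳ (eqB x w))) (sum-replicate-zero k)

walkDegree-∷ : ∀ {k} {x y : Fin k} → x ≢ y → ∀ ys u →
  walkDegree x (y ∷ ys) u ≡ 𝟙 (eqB x u) + 𝟙 (eqB y u) + walkDegree y ys u
walkDegree-∷ {x = x} {y} x≢y ys u =
  trans (∑-distrib-+ (λ w → 𝟙 ((eqB x u ∧ eqB y w) ∨ (eqB x w ∧ eqB y u))) (trav y ys u))
        (cong (_+ walkDegree y ys u) (∑-step-indicator x≢y u))

adj⇒≢ : ∀ {G u v} → T (adj G u v) → u ≢ v
adj⇒≢ {G} {u} uv refl = subst T (irrefl G u) uv

endpoint : ∀ {k} → Fin k → List (Fin k) → Fin k
endpoint x []       = x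
endpoint x (y ∷ ys) = endpoint y ys

occurrences : ∀ {k} → Fin k → List (Fin k) → ℕ
occurrences u l = sum (map (λ x → 𝟙 (eqB x u)) l)

walkDegree+ends≡2*occurrences : ∀ {G} {x} ys → Steps G x ys → ∀ u →
  walkDegree x ys u + 𝟙 (eqB x u) + 𝟙 (eqB (endpoint x ys) u) ≡ 2 * occurrences u (x ∷ ys)
walkDegree+ends≡2*occurrences {G} {x} [] _ u =
  trans (cong (λ t → t + a + a) (sum-replicate-zero (N G)))
        (solve 1 (λ a → con 0 :+ a :+ a := con 2 :* (a :+ con 0)) refl a)
  where
  open +-*-Solver
  a = 𝟙 (eqB x u)
walkDegree+ends≡2*occurrences {G} {x} (y ∷ ys) (xy , st) u = begin
  walkDegree x (y ∷ ys) u + a + e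
    ≡⟨ cong (λ t → t + a + e) (walkDegree-∷ (adj⇒≢ {G} xy) ys u) ⟩
  a + b + walkDegree y ys u + a + e
    ≡⟨ solve 4 (λ a b t e → a :+ b :+ t :+ a :+ e := con 2 :* a :+ (t :+ b :+ e)) refl a b (walkDegree y ys u) e ⟩
  2 * a + (walkDegree y ys u + b + e)
    ≡⟨ cong (2 * a +_) (walkDegree+ends≡2*occurrences ys st u) ⟩
  2 * a + 2 * occurrences u (y ∷ ys)
    ≡⟨ *-distribˡ-+ 2 a _ ⟨
  2 * occurrences u (x ∷ y ∷ ys) ∎
  where
  open ≡-Reasoning
  open +-*-Solver
  a = 𝟙 (eqB x u)
  b = 𝟙 (eqB y u)
  e = 𝟙 (eqB (endpoint y ys) u)

occurrences≡0⇒walkDegree≡0 : ∀ {G} {x} ys → Steps G x ys → ∀ {u} →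
  occurrences u (x ∷ ys) ≡ 0 → walkDegree x ys u ≡ 0
occurrences≡0⇒walkDegree≡0 ys st {u} occ≡0 =
  m+n≡0⇒m≡0 _ (m+n≡0⇒m≡0 _ (trans (walkDegree+ends≡2*occurrences ys st u) (cong (2 *_) occ≡0)))

∉⇒occurrences≡0 : ∀ {k} {u : Fin k} l → u ∉ l → occurrences u l ≡ 0
∉⇒occurrences≡0 []      _  = refl
∉⇒occurrences≡0 (x ∷ l) u∉ =
  cong₂ _+_ (cong 𝟙 (eqB-≢ (u∉ ∘ here ∘ sym))) (∉⇒occurrences≡0 l (u∉ ∘ there))

∉⇒walkDegree≡0 : ∀ {G} (W : Walk G) {u} → u ∉ start W ∷ rest W → walkDegree (start W) (rest W) u ≡ 0
∉⇒walkDegree≡0 W u∉ =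
  occurrences≡0⇒walkDegree≡0 (rest W) (valid W) (∉⇒occurrences≡0 (start W ∷ rest W) u∉)

step-avoids-nonedge : ∀ {G} {x y u v} → T (adj G x y) → adj G u v ≡ false → (eqB x u ∧ eqB y v) ≡ false
step-avoids-nonedge {x = x} {y} {u} {v} xy uv with x ≟ u | y ≟ v
... | yes refl | yes refl = ⊥-elim (subst T uv xy)
... | yes _    | no _     = refl
... | no _     | _        = refl

trav-nonedge : ∀ {G} {x} ys → Steps G x ys → ∀ {u v} → adj G u v ≡ false → trav x ys u v ≡ 0
trav-nonedge []       _         _  = refl
trav-nonedge {G} {x} (y ∷ ys) (xy , st) {u} {v} uv =
  trans (cong₂ (λ p q → 𝟙 (p ∨ q) + trav y ys u v)
               (step-avoids-nonedge {G} xy uv)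
               (step-avoids-nonedge {G} {x} {y} {v} {u} xy (trans (adj-sym G v u) uv)))
        (trav-nonedge ys st uv)

Adjacent⇒adj : ∀ {G} (W : Walk G) {u v} → Adjacent G W u v → adj G u v ≡ true
Adjacent⇒adj {G} W {u} {v} uv with adj G u v in e
... | true  = refl
... | false = ⊥-elim (uv (trav-nonedge (rest W) (valid W) e))

adj⇒Adjacent : ∀ {G} (W : Walk G) {u v} → adj G u v ≡ true → Adjacent G W u v
adj⇒Adjacent {G} W {u} {v} e rewrite e = λ ()

ProperColouring : (G : Graph) → (Fin (N G) → Bool) → Set
ProperColouring G p = ∀ {u v} → T (adj G u v) → p v ≡ not (p u)

length-filterᵇ-∷ : ∀ {A : Set} (p : A → Bool) x xs →
  length (filterᵇ p (x ∷ xs)) ≡ 𝟙 (p x) + length (filterᵇ p xs)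
length-filterᵇ-∷ p x xs with p x
... | true  = refl
... | false = refl

walk-alternates-colours : ∀ {G p} → ProperColouring G p → ∀ {x} ys → Steps G x ys →
  2 * length (filterᵇ p (x ∷ ys)) ≤ 𝟙 (p x) + suc (length ys)
walk-alternates-colours {p = p} proper {x} [] _ with p x
... | true  = s≤s (s≤s z≤n)
... | false = z≤n
walk-alternates-colours {p = p} proper {x} (y ∷ ys) (xy , st) = begin
  2 * length (filterᵇ p (x ∷ y ∷ ys))        ≡⟨ cong (2 *_) (length-filterᵇ-∷ p x (y ∷ ys)) ⟩
  2 * (a + c)                                 ≡⟨ *-distribˡ-+ 2 a c ⟩
  2 * a + 2 * c                               ≤⟨ +-monoʳ-≤ (2 * a) (walk-alternates-colours proper ys st) ⟩
  2 * a + (𝟙 (p y) + suc (length ys))         ≡⟨ cong (λ b → 2 * a + (𝟙 b + suc (length ys))) (proper xy) ⟩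
  2 * a + (𝟙 (not (p x)) + suc (length ys))   ≡⟨ solve 3 (λ a b l → con 2 :* a :+ (b :+ l) := a :+ ((a :+ b) :+ l))
                                                         refl a (𝟙 (not (p x))) (suc (length ys)) ⟩
  a + ((a + 𝟙 (not (p x))) + suc (length ys)) ≡⟨ cong (λ t → a + (t + suc (length ys))) (𝟙+𝟙-not (p x)) ⟩
  a + suc (length (y ∷ ys))                   ∎
  where
  open ≤-Reasoning
  open +-*-Solver
  a = 𝟙 (p x)
  c = length (filterᵇ p (y ∷ ys))

injection-into-list⇒≤length : ∀ {A : Set} {n} {l : List A} (f : Fin n → A) → Injective _≡_ _≡_ f →
  (∀ i → f i ∈ l) → n ≤ length l
injection-into-list⇒≤length {l = l} f f-inj f∈l = injective⇒≤ {f = index ∘ f∈l} λ {i} {j} same-index →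
  f-inj (trans (lookup-index (f∈l i)) (trans (cong (lookup l) same-index) (sym (lookup-index (f∈l j)))))

covering-colour-class⇒2n∸2≤length : ∀ {G p} → ProperColouring G p → ∀ {x} ys → Steps G x ys →
  ∀ {n} (f : Fin n → Fin (N G)) → Injective _≡_ _≡_ f → (∀ i → p (f i) ≡ true) →
  (∀ i → f i ∈ x ∷ ys) → 2 * n ∸ 2 ≤ length ys
covering-colour-class⇒2n∸2≤length {p = p} proper {x} ys st {n} f f-inj pf f∈walk =
  m≤n+o⇒m∸n≤o (2 * n) 2 (begin
    2 * n                           ≤⟨ *-monoʳ-≤ 2 (injection-into-list⇒≤length f f-inj f∈filter) ⟩
    2 * length (filterᵇ p (x ∷ ys)) ≤⟨ walk-alternates-colours proper ys st ⟩
    𝟙 (p x) + suc (length ys)       ≤⟨ +-monoˡ-≤ (suc (length ys)) (𝟙≤1 (p x)) ⟩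
    2 + length ys                   ∎)
  where
  open ≤-Reasoning
  f∈filter : ∀ i → f i ∈ filterᵇ p (x ∷ ys)
  f∈filter i = ∈-filter⁺ (T? ∘ p) (f∈walk i) (Equivalence.from T-≡ (pf i))

spokes : ∀ {k} → Fin k → List (Fin k) → List (Fin k)
spokes h []       = []
spokes h (y ∷ ys) = h ∷ y ∷ spokes h ys

steps-spokes : ∀ {G} {h x} ys → All (λ y → T (adj G y h)) (x ∷ ys) → Steps G x (spokes h ys)
steps-spokes         []       _                  = tt
steps-spokes {G} {h} (y ∷ ys) (xh ∷ yh ∷ rest-h) = xh , subst T (adj-sym G y h) yh , steps-spokes ys (yh ∷ rest-h)

length-spokes : ∀ {k} (h : Fin k) ys → length (spokes h ys) ≡ 2 * length ys
length-spokes h []       = refl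
length-spokes h (y ∷ ys) = trans (cong (2 +_) (length-spokes h ys)) (sym (*-suc 2 (length ys)))

endpoint-spokes : ∀ {k} (h x : Fin k) ys → endpoint x (spokes h ys) ≡ endpoint x ys
endpoint-spokes h x []       = refl
endpoint-spokes h x (y ∷ ys) = endpoint-spokes h y ys

occurrences-spokes : ∀ {k} (h x : Fin k) ys u →
  occurrences u (x ∷ spokes h ys) ≡ length ys * 𝟙 (eqB h u) + occurrences u (x ∷ ys)
occurrences-spokes h x []       u = refl
occurrences-spokes h x (y ∷ ys) u = begin
  a + (c + occurrences u (y ∷ spokes h ys))
    ≡⟨ cong (λ t → a + (c + t)) (occurrences-spokes h y ys u) ⟩
  a + (c + (length ys * c + occurrences u (y ∷ ys)))
    ≡⟨ solve 4 (λ a c l o → a :+ (c :+ (l :* c :+ o)) := (c :+ l :* c) :+ (a :+ o))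
               refl a c (length ys) (occurrences u (y ∷ ys)) ⟩
  (c + length ys * c) + (a + occurrences u (y ∷ ys)) ∎
  where
  open ≡-Reasoning
  open +-*-Solver
  a = 𝟙 (eqB x u)
  c = 𝟙 (eqB h u)

endpoint-tabulate : ∀ {k l} (f : Fin (suc k) → Fin l) → endpoint (f zero) (tabulate (f ∘ suc)) ≡ f (fromℕ k)
endpoint-tabulate {zero}  f = refl
endpoint-tabulate {suc k} f = endpoint-tabulate (f ∘ suc)

occurrences-tabulate-injective : ∀ {k l} {f : Fin k → Fin l} → Injective _≡_ _≡_ f →
  ∀ i → occurrences (f i) (tabulate f) ≡ 1
occurrences-tabulate-injective {k} {f = f} f-inj i = begin
  occurrences (f i) (tabulate f) ≡⟨ sum-map-tabulate (λ x → 𝟙 (eqB x (f i))) f ⟩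
  ∑[ j < k ] 𝟙 (eqB (f j) (f i)) ≡⟨ sum-cong-≗ {k} (λ j → cong 𝟙 (trans (eqB-injective f-inj j i)
                                                                         (eqB-comm j i))) ⟩
  ∑[ j < k ] 𝟙 (eqB i j)         ≡⟨ ∑-indicator i ⟩
  1                              ∎
  where open ≡-Reasoning

occurrences-tabulate-∉ : ∀ {k l} (f : Fin k → Fin l) {u} → (∀ i → f i ≢ u) → occurrences u (tabulate f) ≡ 0
occurrences-tabulate-∉ {k} f {u} f≢u =
  trans (sum-map-tabulate (λ x → 𝟙 (eqB x u)) f)
        (trans (sum-cong-≗ {k} (cong 𝟙 ∘ eqB-≢ ∘ f≢u)) (sum-replicate-zero k))

inA-↑ˡ : ∀ {n} m (i : Fin n) → inA n (i ↑ˡ m) ≡ true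
inA-↑ˡ m zero    = refl
inA-↑ˡ m (suc i) = inA-↑ˡ m i

inA-↑ʳ : ∀ n {m} (j : Fin m) → inA n (n ↑ʳ j) ≡ false
inA-↑ʳ zero    j = refl
inA-↑ʳ (suc n) j = inA-↑ʳ n j

↑ˡ≢↑ʳ : ∀ {n m} (i : Fin n) (j : Fin m) → i ↑ˡ m ≢ n ↑ʳ j
↑ˡ≢↑ʳ {n} {m} i j e with () ← trans (sym (inA-↑ˡ m i)) (trans (cong (inA n) e) (inA-↑ʳ n j))

adj-K-↑ˡ-↑ʳ : ∀ {n m} (i : Fin n) (j : Fin m) → adj (K n m) (i ↑ˡ m) (n ↑ʳ j) ≡ true
adj-K-↑ˡ-↑ʳ {n} {m} i j = cong₂ _xor_ (inA-↑ˡ m i) (inA-↑ʳ n j)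

inA-isProperColouring : ∀ n m → ProperColouring (K n m) (inA n)
inA-isProperColouring n m {u} {v} = xor-flip (inA n u) (inA n v)
  where
  xor-flip : ∀ a b → T (a xor b) → b ≡ not a
  xor-flip true  false _ = refl
  xor-flip false true  _ = refl

data Side (n m : ℕ) : Fin (n + m) → Set where
  left  : (i : Fin n) → Side n m (i ↑ˡ m)
  right : (j : Fin m) → Side n m (n ↑ʳ j)

side : ∀ n m (u : Fin (n + m)) → Side n m u
side n m u with splitAt n u in eq
... | inj₁ i = subst (Side n m) (splitAt⁻¹-↑ˡ eq) (left i)
... | inj₂ j = subst (Side n m) (splitAt⁻¹-↑ʳ eq) (right j)

degree-K : ∀ n m {u : Fin (n + m)} {b} → inA n u ≡ b →
  degree (K n m) u ≡ ∑[ i < n ] 𝟙 (b xor true) + ∑[ j < m ] 𝟙 (b xor false)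
degree-K n m {u} refl = trans (∑-↑ˡ-↑ʳ n m _) (cong₂ _+_
  (sum-cong-≗ {n} λ i → cong (λ a → 𝟙 (inA n u xor a)) (inA-↑ˡ m i))
  (sum-cong-≗ {m} λ j → cong (λ a → 𝟙 (inA n u xor a)) (inA-↑ʳ n j)))

deg-K-↑ˡ : ∀ {n m} (W : Walk (K n m)) i →
  deg (K n m) W (i ↑ˡ m) ≡ m + walkDegree (start W) (rest W) (i ↑ˡ m)
deg-K-↑ˡ {n} {m} W i = trans (deg≡degree+walkDegree W (i ↑ˡ m)) (cong (_+ walkDegree (start W) (rest W) (i ↑ˡ m))
  (trans (degree-K n m (inA-↑ˡ m i)) (cong₂ _+_ (sum-replicate-zero n) (∑-ones m))))

deg-K-↑ʳ : ∀ {n m} (W : Walk (K n m)) j →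
  deg (K n m) W (n ↑ʳ j) ≡ n + walkDegree (start W) (rest W) (n ↑ʳ j)
deg-K-↑ʳ {n} {m} W j = trans (deg≡degree+walkDegree W (n ↑ʳ j)) (cong (_+ walkDegree (start W) (rest W) (n ↑ʳ j))
  (trans (degree-K n m (inA-↑ʳ n j)) (trans (cong₂ _+_ (∑-ones n) (sum-replicate-zero m)) (+-identityʳ n))))

irregularising-K : ∀ {n m} (W : Walk (K n m)) →
  (∀ i j → m + walkDegree (start W) (rest W) (i ↑ˡ m) ≢ n + walkDegree (start W) (rest W) (n ↑ʳ j)) →
  Irregularising (K n m) W
irregularising-K {n} {m} W separated u v uv with side n m u | side n m v | Adjacent⇒adj W uv
... | left i  | left i′  | e with () ← trans (sym (cong₂ _xor_ (inA-↑ˡ m i) (inA-↑ˡ m i′))) e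
... | left i  | right j  | _ = λ d → separated i j (trans (sym (deg-K-↑ˡ W i)) (trans d (deg-K-↑ʳ W j)))
... | right j | left i   | _ = λ d → separated i j (trans (sym (deg-K-↑ˡ W i)) (trans (sym d) (deg-K-↑ʳ W j)))
... | right j | right j′ | e with () ← trans (sym (cong₂ _xor_ (inA-↑ʳ n j) (inA-↑ʳ n j′))) e

MLW-K-unbalanced : ∀ n m → suc n ≢ m → MLW≡ (K (suc n) m) 0
MLW-K-unbalanced n m n≢m = (W , irregularising-K W separated , refl) , λ _ _ → z≤n
  where
  W : Walk (K (suc n) m)
  W = walk zero [] tt
  separated : ∀ i j → m + walkDegree zero [] (i ↑ˡ m) ≢ suc n + walkDegree zero [] (suc n ↑ʳ j)
  separated i j = n≢m ∘ sym ∘ +-cancelʳ-≡ _ m (suc n)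

irregularising⇒¬misses-both-sides : ∀ {n} (W : Walk (K n n)) → Irregularising (K n n) W →
  ∀ i j → i ↑ˡ n ∉ start W ∷ rest W → n ↑ʳ j ∉ start W ∷ rest W → ⊥
irregularising⇒¬misses-both-sides {n} W irr i j i∉ j∉ =
  irr (i ↑ˡ n) (n ↑ʳ j) (adj⇒Adjacent W (adj-K-↑ˡ-↑ʳ i j)) (begin
    deg (K n n) W (i ↑ˡ n)                     ≡⟨ deg-K-↑ˡ W i ⟩
    n + walkDegree (start W) (rest W) (i ↑ˡ n) ≡⟨ cong (n +_) (trans (∉⇒walkDegree≡0 W i∉)
                                                                      (sym (∉⇒walkDegree≡0 W j∉))) ⟩
    n + walkDegree (start W) (rest W) (n ↑ʳ j) ≡⟨ deg-K-↑ʳ W j ⟨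
    deg (K n n) W (n ↑ʳ j)                     ∎)
  where open ≡-Reasoning

infix 4 _∈?_

_∈?_ : ∀ {k} (u : Fin k) (l : List (Fin k)) → Dec (u ∈ l)
u ∈? l = any? (u ≟_) l

irregularising⇒covers-a-side : ∀ {n} (W : Walk (K n n)) → Irregularising (K n n) W →
  (∀ i → i ↑ˡ n ∈ start W ∷ rest W) ⊎ (∀ j → n ↑ʳ j ∈ start W ∷ rest W)
irregularising⇒covers-a-side {n} W irr
  with all? (λ i → i ↑ˡ n ∈? start W ∷ rest W) | all? (λ j → n ↑ʳ j ∈? start W ∷ rest W)
... | yes covers-left | _                = inj₁ covers-left
... | no _            | yes covers-right = inj₂ covers-right
... | no ¬covers-left | no ¬covers-right =
  let (i , i∉) = ¬∀⟶∃¬ n _ (λ i → i ↑ˡ n ∈? start W ∷ rest W) ¬covers-left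
      (j , j∉) = ¬∀⟶∃¬ n _ (λ j → n ↑ʳ j ∈? start W ∷ rest W) ¬covers-right
  in ⊥-elim (irregularising⇒¬misses-both-sides W irr i j i∉ j∉)

irregularising⇒2n∸2≤walkLength : ∀ n (W : Walk (K n n)) → Irregularising (K n n) W → 2 * n ∸ 2 ≤ walkLength W
irregularising⇒2n∸2≤walkLength n W irr with irregularising⇒covers-a-side W irr
... | inj₁ covers-left  = covering-colour-class⇒2n∸2≤length (inA-isProperColouring n n) (rest W) (valid W)
                            (_↑ˡ n) (↑ˡ-injective n _ _) (inA-↑ˡ n) covers-left
... | inj₂ covers-right = covering-colour-class⇒2n∸2≤length (cong not ∘ inA-isProperColouring n n)
                            (rest W) (valid W) (n ↑ʳ_) (↑ʳ-injective n _ _) (cong not ∘ inA-↑ʳ n) covers-right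

zero≢fromℕ : ∀ {k} → 1 ≤ k → zero ≢ fromℕ k
zero≢fromℕ {suc k} _ = λ ()

-- For k = 1 both leaves are ends of the star walk; for k ≥ 2 already 2k > 2.
hub-degree-exceeds-leaf : ∀ {k} → 1 ≤ k → (i : Fin (suc k)) →
  2 * k + (𝟙 (eqB zero i) + 𝟙 (eqB (fromℕ k) i)) ≢ 2
hub-degree-exceeds-leaf {suc zero}    _ zero       = λ ()
hub-degree-exceeds-leaf {suc zero}    _ (suc zero) = λ ()
hub-degree-exceeds-leaf {suc (suc k)} _ i e =
  4≰2 (subst (4 ≤_) e (≤-trans (*-monoʳ-≤ 2 (s≤s (s≤s z≤n))) (m≤m+n (2 * suc (suc k)) _)))
  where
  4≰2 : ¬ 4 ≤ 2
  4≰2 (s≤s (s≤s ()))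

module _ (k : ℕ) where
  private
    n : ℕ
    n = suc k
    inject : Fin n → Fin (n + n)
    inject i = i ↑ˡ n
    inject-injective : Injective _≡_ _≡_ inject
    inject-injective = ↑ˡ-injective n _ _
    leaves : List (Fin (n + n))
    leaves = tabulate (inject ∘ suc)
    endCount : Fin n → ℕ
    endCount i = 𝟙 (eqB zero i) + 𝟙 (eqB (fromℕ k) i)

  hub : Fin (n + n)
  hub = n ↑ʳ zero

  starWalk : Walk (K n n)
  starWalk = walk (inject zero) (spokes hub leaves)
    (steps-spokes leaves (tabulate⁺ {f = inject} λ i → Equivalence.from T-≡ (adj-K-↑ˡ-↑ʳ i zero)))

  walkLength-starWalk : walkLength starWalk ≡ 2 * k
  walkLength-starWalk = trans (length-spokes hub leaves) (cong (2 *_) (length-tabulate (inject ∘ suc)))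

  private
    wd : Fin (n + n) → ℕ
    wd = walkDegree (start starWalk) (rest starWalk)

  starWalk-handshake : ∀ u → wd u + 𝟙 (eqB (inject zero) u) + 𝟙 (eqB (inject (fromℕ k)) u)
                             ≡ 2 * (k * 𝟙 (eqB hub u) + occurrences u (tabulate inject))
  starWalk-handshake u = begin
    wd u + 𝟙 (eqB (inject zero) u) + 𝟙 (eqB (inject (fromℕ k)) u)
      ≡⟨ cong (λ e → wd u + 𝟙 (eqB (inject zero) u) + 𝟙 (eqB e u)) end ⟨
    wd u + 𝟙 (eqB (inject zero) u) + 𝟙 (eqB (endpoint (inject zero) (spokes hub leaves)) u)
      ≡⟨ walkDegree+ends≡2*occurrences (spokes hub leaves) (valid starWalk) u ⟩
    2 * occurrences u (inject zero ∷ spokes hub leaves)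
      ≡⟨ cong (2 *_) (occurrences-spokes hub (inject zero) leaves u) ⟩
    2 * (length leaves * 𝟙 (eqB hub u) + occurrences u (tabulate inject))
      ≡⟨ cong (λ l → 2 * (l * 𝟙 (eqB hub u) + occurrences u (tabulate inject)))
              (length-tabulate (inject ∘ suc)) ⟩
    2 * (k * 𝟙 (eqB hub u) + occurrences u (tabulate inject)) ∎
    where
    open ≡-Reasoning
    end : endpoint (inject zero) (spokes hub leaves) ≡ inject (fromℕ k)
    end = trans (endpoint-spokes hub (inject zero) leaves) (endpoint-tabulate inject)

  walkDegree-hub : wd hub ≡ 2 * k
  walkDegree-hub = begin
    wd hub
      ≡⟨ trans (+-identityʳ (wd hub + 0)) (+-identityʳ (wd hub)) ⟨
    wd hub + 0 + 0
      ≡⟨ cong₂ (λ a b → wd hub + 𝟙 a + 𝟙 b)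
               (eqB-≢ (↑ˡ≢↑ʳ {n} {n} zero zero)) (eqB-≢ (↑ˡ≢↑ʳ {n} {n} (fromℕ k) zero)) ⟨
    wd hub + 𝟙 (eqB (inject zero) hub) + 𝟙 (eqB (inject (fromℕ k)) hub)
      ≡⟨ starWalk-handshake hub ⟩
    2 * (k * 𝟙 (eqB hub hub) + occurrences hub (tabulate inject))
      ≡⟨ cong₂ (λ a o → 2 * (k * 𝟙 a + o))
               (eqB-refl hub) (occurrences-tabulate-∉ inject (λ i → ↑ˡ≢↑ʳ i zero)) ⟩
    2 * (k * 1 + 0)
      ≡⟨ cong (2 *_) (trans (+-identityʳ (k * 1)) (*-identityʳ k)) ⟩
    2 * k ∎
    where open ≡-Reasoning

  walkDegree-leaf : ∀ i → wd (inject i) + endCount i ≡ 2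
  walkDegree-leaf i = begin
    wd (inject i) + endCount i
      ≡⟨ +-assoc (wd (inject i)) _ _ ⟨
    wd (inject i) + 𝟙 (eqB zero i) + 𝟙 (eqB (fromℕ k) i)
      ≡⟨ cong₂ (λ a b → wd (inject i) + 𝟙 a + 𝟙 b)
               (eqB-injective inject-injective zero i) (eqB-injective inject-injective (fromℕ k) i) ⟨
    wd (inject i) + 𝟙 (eqB (inject zero) (inject i)) + 𝟙 (eqB (inject (fromℕ k)) (inject i))
      ≡⟨ starWalk-handshake (inject i) ⟩
    2 * (k * 𝟙 (eqB hub (inject i)) + occurrences (inject i) (tabulate inject))
      ≡⟨ cong₂ (λ a o → 2 * (k * 𝟙 a + o))
               (eqB-≢ (↑ˡ≢↑ʳ i zero ∘ sym)) (occurrences-tabulate-injective inject-injective i) ⟩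
    2 * (k * 0 + 1)
      ≡⟨ cong (λ t → 2 * (t + 1)) (*-zeroʳ k) ⟩
    2 ∎
    where open ≡-Reasoning

  walkDegree-spare : ∀ j → wd (n ↑ʳ suc j) ≡ 0
  walkDegree-spare j = occurrences≡0⇒walkDegree≡0 (rest starWalk) (valid starWalk) (begin
    occurrences (n ↑ʳ suc j) (inject zero ∷ spokes hub leaves)
      ≡⟨ occurrences-spokes hub (inject zero) leaves (n ↑ʳ suc j) ⟩
    length leaves * 𝟙 (eqB hub (n ↑ʳ suc j)) + occurrences (n ↑ʳ suc j) (tabulate inject)
      ≡⟨ cong₂ (λ a o → length leaves * 𝟙 a + o)
               (eqB-≢ ((λ ()) ∘ ↑ʳ-injective n zero (suc j)))
               (occurrences-tabulate-∉ inject (λ i → ↑ˡ≢↑ʳ i (suc j))) ⟩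
    length leaves * 0 + 0
      ≡⟨ trans (+-identityʳ _) (*-zeroʳ (length leaves)) ⟩
    0 ∎)
    where open ≡-Reasoning

  starWalk-irregularising : 1 ≤ k → Irregularising (K n n) starWalk
  starWalk-irregularising 1≤k = irregularising-K starWalk λ i j → separated i j ∘ +-cancelˡ-≡ n _ _
    where
    separated : ∀ i j → wd (inject i) ≢ wd (n ↑ʳ j)
    separated i zero    e = hub-degree-exceeds-leaf 1≤k i
      (subst (λ d → d + endCount i ≡ 2) (trans e walkDegree-hub) (walkDegree-leaf i))
    separated i (suc j) e = distinct⇒𝟙+𝟙≢2 (zero≢fromℕ 1≤k) i
      (subst (λ d → d + endCount i ≡ 2) (trans e (walkDegree-spare j)) (walkDegree-leaf i))

MLW-K-balanced : ∀ n → 2 ≤ n → MLW≡ (K n n) (2 * n ∸ 2)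
MLW-K-balanced (suc k) (s≤s 1≤k) =
  (starWalk k , starWalk-irregularising k 1≤k , trans (walkLength-starWalk k) (cong (_∸ 2) (sym (*-suc 2 k)))) ,
  irregularising⇒2n∸2≤walkLength (suc k)

theorem5p2 : (n m : ℕ) → 1 ≤ n → 1 ≤ m → 3 ≤ n + m →
    (n ≢ m → MLW≡ (K n m) 0) × (n ≡ m → 2 ≤ n → MLW≡ (K n m) (2 * n ∸ 2))
theorem5p2 (suc n) m _ _ _ = MLW-K-unbalanced n m , λ { refl → MLW-K-balanced (suc n) }
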